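{- Let $C_n$ denote the cycle on $n$ vertices. If $4\leq n\leq 21$ and $n\notin\{5,7\}$, then $\sigma(C_n)=4$. If $n\in\{5,7\}$, then $\sigma(C_n)=5$.
   Context: A $k$-coloring of a graph $G$ is a function $c\colon V(G)\to\{1,\dots,k\}$. A walk in $G$ is a sequence $v_1\cdots v_r$ of vertices with $v_iv_{i+1}\in E(G)$ for all $i$. A sequence $a_1\cdots a_{2t}$ is repetitive if $a_i=a_{i+t}$ for all $i\in\{1,\dots,t\}$. A walk $v_1\cdots v_{2t}$ is repetitive (with respect to $c$) if $c(v_1)\cdots c(v_{2t})$ is repetitive, and boring if $v_i=v_{i+t}$ for all $i\in\{1,\dots,t\}$. A coloring is walk-nonrepetitive if every repetitive walk is boring. $\sigma(G)$ is the minimum $k$ such that $G$ has a walk-nonrepetitive $k$-coloring. -}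

module Defs where

open import Data.Nat using (ℕ; zero; suc; _+_; _*_; _<_; _≤_; _%_; NonZero)
open import Data.Fin using (Fin; toℕ)
open import Data.Product using (Σ; _×_; _,_; ∃)
open import Relation.Binary.PropositionalEquality using (_≡_)
open import Relation.Nullary using (¬_)
open import Data.Sum using (_⊎_)
open import Level using (0ℓ)

record Graph : Set₁ where
  field
    size : ℕ
    Adj  : Fin size → Fin size → Set

open Graph public

Vertex : Graph → Set
Vertex G = Fin (size G)

SuccMod : (n : ℕ) → ℕ → ℕ → Set
SuccMod n i j = (suc i < n × j ≡ suc i) ⊎ (suc i ≡ n × j ≡ 0)

-- The cycle C_n on vertices 0,…,n-1 : i ~ j iff j ≡ i+1 (mod n) or i ≡ j+1 (mod n).
-- (Used here only for n ≥ 4, where this is the simple n-cycle.)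
Cycle : ℕ → Graph
Cycle n = record
  { size = n
  ; Adj  = λ i j → SuccMod n (toℕ i) (toℕ j) ⊎ SuccMod n (toℕ j) (toℕ i)
  }

Coloring : Graph → ℕ → Set
Coloring G k = Vertex G → Fin k

-- A sequence v_0 … v_{2t-1} (stored as a function on ℕ; only the first 2t
-- entries matter) is a walk of length 2t if consecutive entries are adjacent.
IsWalk : (G : Graph) → (t : ℕ) → (ℕ → Vertex G) → Set
IsWalk G t w = ∀ i → suc i < t + t → Adj G (w i) (w (suc i))

Repetitive : (G : Graph) {k : ℕ} → Coloring G k → (t : ℕ) → (ℕ → Vertex G) → Set
Repetitive G c t w = ∀ i → i < t → c (w i) ≡ c (w (i + t))

Boring : (G : Graph) → (t : ℕ) → (ℕ → Vertex G) → Set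
Boring G t w = ∀ i → i < t → w i ≡ w (i + t)

WalkNonrepetitive : (G : Graph) {k : ℕ} → Coloring G k → Set
WalkNonrepetitive G c =
  ∀ (t : ℕ) (w : ℕ → Vertex G) → IsWalk G t w → Repetitive G c t w → Boring G t w

σ≡ : Graph → ℕ → Set
σ≡ G k =
  (Σ (Coloring G k) λ c → WalkNonrepetitive G c) ×
  (∀ m → m < k → (c : Coloring G m) → ¬ WalkNonrepetitive G c)

-- In a repetitive walk v₀ … v₂ₜ₋₁ the pairs (vᵢ , vᵢ₊ₜ) move in parallel along edges and always
-- carry equal colours.  If the colouring is injective on neighbourhoods, one coincidence
-- vᵢ = vᵢ₊ₜ propagates along the walk, so a walk with v₀ = vₜ is boring; otherwise every pair
-- consists of distinct vertices of the same colour ("twins").  A labelling of twin pairs that is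
-- invariant under parallel steps, and separates each pair (a , b) from every pair (x , y) with x
-- adjacent to b, then rules out the last pair (vₜ₋₁ , v₂ₜ₋₁), because vₜ₋₁ is adjacent to vₜ.
-- For each cycle length such a colouring and labelling, found by computer, is checked.
-- Conversely, a walk-nonrepetitive colouring gives distinct colours to any three consecutive
-- vertices of a cycle; with three colours this forces period three along a path, i.e. a
-- repetitive walk of length six.  For C₅ and C₇ an exhaustive search shows that every
-- 4-colouring repeats a colour at distance at most two or has such a walk around the cycle.
module Submission where

open import Data.Empty using (⊥-elim)
open import Data.Fin using (Fin; toℕ; #_)
open import Data.Fin.Properties using (_≟_; all?; any?; toℕ-fromℕ<)
open import Data.List.Base using (List; []; _∷_)
import Data.Nat.Properties as ℕ
open import Data.List.Membership.DecPropositional ℕ._≟_ using (_∈_; _∈?_)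
open import Data.List.Relation.Unary.All as All using (All; []; _∷_)
open import Data.Nat.Base using (ℕ; zero; suc; _+_; _∸_; _<_; _≤_; z<s; s<s; s≤s; NonZero)
open import Data.Nat.DivMod
  using (_%_; _/_; _mod_; m≡m%n+[m/n]*n; [m+kn]%n≡m%n; m<n⇒m%n≡m; m%n<n; n%n≡0; %-congˡ;
         %-distribˡ-+; m≤n⇒[n∸m]%m≡n%m)
open import Data.Product.Base using (Σ; ∃; _×_; _,_; proj₁; proj₂)
open import Data.Sum.Base using (_⊎_; inj₁; inj₂; swap)
open import Data.Vec.Base using (Vec; []; _∷_; lookup; tabulate; replicate)
open import Data.Vec.Properties using (lookup∘tabulate)
open import Function.Base using (_∘_)
open import Relation.Binary.Definitions using (Symmetric; Decidable; DecidableEquality)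
open import Relation.Binary.PropositionalEquality
  using (_≡_; _≢_; _≗_; refl; sym; trans; cong; subst₂; module ≡-Reasoning)
open import Relation.Nullary.Decidable
  using (Dec; yes; no; True; toWitness; map′; ¬?; _×-dec_; _⊎-dec_; _→-dec_)
open import Relation.Nullary.Negation using (¬_)

open import Defs

-- Labellings certifying walk-nonrepetitiveness

module _ (G : Graph) {k : ℕ} (c : Coloring G k) where

  Twins : Vertex G → Vertex G → Set
  Twins x y = x ≢ y × c x ≡ c y

  InjectiveOnNeighbourhoods : Set
  InjectiveOnNeighbourhoods = ∀ u x → Adj G u x → ∀ y → Adj G u y → c x ≡ c y → x ≡ y

  module _ {L : Set} (lab : Vertex G → Vertex G → L) where

    InvariantLabelling : Set
    InvariantLabelling =
      ∀ x y → Twins x y → ∀ x′ → Adj G x x′ → ∀ y′ → Adj G y y′ → c x′ ≡ c y′ →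
      lab x′ y′ ≡ lab x y

    SeparatingLabelling : Set
    SeparatingLabelling =
      ∀ x b → Adj G x b → ∀ a → Twins a b → ∀ y → Twins x y → lab a b ≢ lab x y

module _ (G : Graph) (sym-adj : Symmetric (Adj G)) {k : ℕ} (c : Coloring G k) where

  walkNonrepetitive⇒injectiveOnNeighbourhoods :
    WalkNonrepetitive G c → InjectiveOnNeighbourhoods G c
  walkNonrepetitive⇒injectiveOnNeighbourhoods wnr u x u~x y u~y cx≡cy =
    wnr 2 w walk rep 0 z<s
    where
    w : ℕ → Vertex G
    w 0 = x
    w 2 = y
    w _ = u

    walk : IsWalk G 2 w
    walk 0 _ = sym-adj u~x
    walk 1 _ = u~y
    walk 2 _ = sym-adj u~y
    walk (suc (suc (suc _))) (s<s (s<s (s<s (s<s ()))))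

    rep : Repetitive G c 2 w
    rep 0 _ = cx≡cy
    rep 1 _ = refl
    rep (suc (suc _)) (s<s (s<s ()))

  module _ (injective : InjectiveOnNeighbourhoods G c) where

    parallel-step-coincides : ∀ {x y x′ y′} → x ≡ y → Adj G x x′ → Adj G y y′ →
                              c x′ ≡ c y′ → x′ ≡ y′
    parallel-step-coincides refl x~x′ x~y′ = injective _ _ x~x′ _ x~y′

    parallel-step-twins : ∀ {x y x′ y′} → Twins G c x y → Adj G x x′ → Adj G y y′ →
                          c x′ ≡ c y′ → Twins G c x′ y′
    parallel-step-twins (x≢y , cx≡cy) x~x′ y~y′ cx′≡cy′ =
      (λ x′≡y′ → x≢y (parallel-step-coincides x′≡y′ (sym-adj x~x′) (sym-adj y~y′) cx≡cy)) ,
      cx′≡cy′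

    module _ {L : Set} (lab : Vertex G → Vertex G → L)
             (invariant : InvariantLabelling G c lab) (separating : SeparatingLabelling G c lab)
             where

      module _ {t : ℕ} {w : ℕ → Vertex G} (walk : IsWalk G t w) (rep : Repetitive G c t w)
               where

        private
          earlier : ∀ {i} → suc i < t → i < t
          earlier = ℕ.<-trans (ℕ.n<1+n _)

          first-half-edge : ∀ {i} → suc i < t → Adj G (w i) (w (suc i))
          first-half-edge {i} i+1<t = walk i (ℕ.≤-trans i+1<t (ℕ.m≤m+n t t))

          second-half-edge : ∀ {i} → suc i < t → Adj G (w (i + t)) (w (suc i + t))
          second-half-edge {i} i+1<t = walk (i + t) (ℕ.+-monoˡ-< t i+1<t)

        boring-from-start : w 0 ≡ w t → Boring G t w
        boring-from-start w₀≡wₜ zero    _     = w₀≡wₜ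
        boring-from-start w₀≡wₜ (suc i) i+1<t =
          parallel-step-coincides (boring-from-start w₀≡wₜ i (earlier i+1<t))
            (first-half-edge i+1<t) (second-half-edge i+1<t) (rep (suc i) i+1<t)

        twins-from-start :
          Twins G c (w 0) (w t) → ∀ i → i < t →
          Twins G c (w i) (w (i + t)) × lab (w i) (w (i + t)) ≡ lab (w 0) (w t)
        twins-from-start twins₀ zero    _     = twins₀ , refl
        twins-from-start twins₀ (suc i) i+1<t =
          parallel-step-twins (proj₁ ih) x~x′ y~y′ same ,
          trans (invariant _ _ (proj₁ ih) _ x~x′ _ y~y′ same) (proj₂ ih)
          where
          ih   = twins-from-start twins₀ i (earlier i+1<t)
          x~x′ = first-half-edge i+1<t
          y~y′ = second-half-edge i+1<t
          same = rep (suc i) i+1<t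

      labelling⇒walkNonrepetitive : WalkNonrepetitive G c
      labelling⇒walkNonrepetitive zero w walk rep i ()
      labelling⇒walkNonrepetitive t@(suc t′) w walk rep with w 0 ≟ w t
      ... | yes w₀≡wₜ = boring-from-start walk rep w₀≡wₜ
      ... | no  w₀≢wₜ = ⊥-elim (separating (w t′) (w t) (walk t′ (ℕ.m<m+n t z<s))
                                  (w 0) twins₀ (w (t′ + t)) (proj₁ last) (sym (proj₂ last)))
        where
        twins₀ = w₀≢wₜ , rep 0 z<s
        last   = twins-from-start walk rep twins₀ t′ (ℕ.n<1+n t′)

walkNonrepetitive-cong : ∀ G {k} {c c′ : Coloring G k} → c ≗ c′ →
                         WalkNonrepetitive G c → WalkNonrepetitive G c′
walkNonrepetitive-cong G c≗c′ wnr t w walk rep =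
  wnr t w walk λ i i<t → trans (c≗c′ (w i)) (trans (rep i i<t) (sym (c≗c′ (w (i + t)))))

module _ (G : Graph) (adj? : Decidable (Adj G)) {k : ℕ} (c : Coloring G k) where

  twins? : Decidable (Twins G c)
  twins? x y = ¬? (x ≟ y) ×-dec c x ≟ c y

  injectiveOnNeighbourhoods? : Dec (InjectiveOnNeighbourhoods G c)
  injectiveOnNeighbourhoods? =
    all? λ u → all? λ x → adj? u x →-dec all? λ y → adj? u y →-dec c x ≟ c y →-dec x ≟ y

  module _ {L : Set} (_≟ᴸ_ : DecidableEquality L) (lab : Vertex G → Vertex G → L) where

    invariantLabelling? : Dec (InvariantLabelling G c lab)
    invariantLabelling? =
      all? λ x → all? λ y → twins? x y →-dec all? λ x′ → adj? x x′ →-dec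
      all? λ y′ → adj? y y′ →-dec c x′ ≟ c y′ →-dec lab x′ y′ ≟ᴸ lab x y

    separatingLabelling? : Dec (SeparatingLabelling G c lab)
    separatingLabelling? =
      all? λ x → all? λ b → adj? x b →-dec all? λ a → twins? a b →-dec
      all? λ y → twins? x y →-dec ¬? (lab a b ≟ᴸ lab x y)

repetitive? : ∀ G {k} (c : Coloring G k) t w → Dec (Repetitive G c t w)
repetitive? G c t w =
  map′ (λ rep i → rep {i}) (λ rep {i} → rep i) (ℕ.allUpTo? (λ i → c (w i) ≟ c (w (i + t))) t)

allVectors? : ∀ {a m n} {P : Vec (Fin m) n → Set a} → (∀ v → Dec (P v)) → Dec (∀ v → P v)
allVectors? {n = zero}  P? = map′ (λ p → λ { [] → p }) (λ p → p []) (P? [])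
allVectors? {n = suc n} P? =
  map′ (λ p → λ { (x ∷ xs) → p x xs }) (λ p x xs → p (x ∷ xs))
       (all? λ x → allVectors? λ xs → P? (x ∷ xs))

-- Walks around a cycle

cycle-symmetric : ∀ n → Symmetric (Adj (Cycle n))
cycle-symmetric n = swap

successorMod? : ∀ n i j → Dec (SuccMod n i j)
successorMod? n i j = (suc i ℕ.<? n ×-dec j ℕ.≟ suc i) ⊎-dec (suc i ℕ.≟ n ×-dec j ℕ.≟ 0)

cycle-adjacent? : ∀ n → Decidable (Adj (Cycle n))
cycle-adjacent? n i j = successorMod? n (toℕ i) (toℕ j) ⊎-dec successorMod? n (toℕ j) (toℕ i)

module _ {n : ℕ} .{{_ : NonZero n}} where
  open ≡-Reasoning

  [1+m]%n≡[1+m%n]%n : ∀ m → suc m % n ≡ suc (m % n) % n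
  [1+m]%n≡[1+m%n]%n m = trans (cong (λ l → suc l % n) (m≡m%n+[m/n]*n m n))
                              ([m+kn]%n≡m%n (suc (m % n)) (m / n) n)

  successorMod-% : ∀ m → SuccMod n (m % n) (suc m % n)
  successorMod-% m with suc (m % n) ℕ.<? n
  ... | yes 1+m%n<n = inj₁ (1+m%n<n , trans ([1+m]%n≡[1+m%n]%n m) (m<n⇒m%n≡m 1+m%n<n))
  ... | no  1+m%n≮n =
    inj₂ (1+m%n≡n , trans ([1+m]%n≡[1+m%n]%n m) (trans (%-congˡ 1+m%n≡n) (n%n≡0 n)))
    where 1+m%n≡n = ℕ.≤∧≮⇒≡ (m%n<n m n) 1+m%n≮n

  [d+r]%n≢r : ∀ {d r} → 0 < d → d < n → r < n → (d + r) % n ≢ r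
  [d+r]%n≢r {d} {r} 0<d d<n r<n eq with d + r ℕ.<? n
  ... | yes d+r<n = ℕ.<⇒≢ (ℕ.m<n+m r 0<d) (sym (trans (sym (m<n⇒m%n≡m d+r<n)) eq))
  ... | no  d+r≮n = ℕ.<⇒≢ d<n (ℕ.+-cancelʳ-≡ r d n (begin
    d + r           ≡⟨ ℕ.m∸n+n≡m n≤d+r ⟨
    d + r ∸ n + n   ≡⟨ cong (_+ n) wrapped ⟩
    r + n           ≡⟨ ℕ.+-comm r n ⟩
    n + r           ∎))
    where
    n≤d+r = ℕ.≮⇒≥ d+r≮n
    wrapped : d + r ∸ n ≡ r
    wrapped = begin
      d + r ∸ n        ≡⟨ m<n⇒m%n≡m (ℕ.m<n+o⇒m∸n<o (d + r) n (ℕ.+-mono-< d<n r<n)) ⟨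
      (d + r ∸ n) % n  ≡⟨ m≤n⇒[n∸m]%m≡n%m n≤d+r ⟩
      (d + r) % n      ≡⟨ eq ⟩
      r                ∎

  around : ℕ → Vertex (Cycle n)
  around i = i mod n

  toℕ-around : ∀ i → toℕ (around i) ≡ i % n
  toℕ-around i = toℕ-fromℕ< (m%n<n i n)

  around-adjacent : ∀ i → Adj (Cycle n) (around i) (around (suc i))
  around-adjacent i =
    inj₁ (subst₂ (SuccMod n) (sym (toℕ-around i)) (sym (toℕ-around (suc i))) (successorMod-% i))

  around-distinct : ∀ i {d} → 0 < d → d < n → around i ≢ around (d + i)
  around-distinct i {d} 0<d d<n eq = [d+r]%n≢r 0<d d<n (m%n<n i n) (begin
    (d + i % n) % n        ≡⟨ cong (λ l → (l + i % n) % n) (m<n⇒m%n≡m d<n) ⟨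
    (d % n + i % n) % n    ≡⟨ %-distribˡ-+ d i n ⟨
    (d + i) % n            ≡⟨ toℕ-around (d + i) ⟨
    toℕ (around (d + i))   ≡⟨ cong toℕ eq ⟨
    toℕ (around i)         ≡⟨ toℕ-around i ⟩
    i % n                  ∎)

  module _ {k : ℕ} (c : Coloring (Cycle n) k) where

    Square : ℕ → ℕ → Set
    Square t i = Repetitive (Cycle n) c t (λ j → around (j + i))

    Obstruction : ℕ → Set
    Obstruction i = Square 1 i ⊎ c (around i) ≡ c (around (2 + i)) ⊎ Square 3 i

    Obstructed : Set
    Obstructed = ∃ λ (i : Fin n) → Obstruction (toℕ i)

    obstructed? : Dec Obstructed
    obstructed? = any? λ i →
      repetitive? (Cycle n) c 1 (λ j → around (j + toℕ i)) ⊎-dec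
      c (around (toℕ i)) ≟ c (around (2 + toℕ i)) ⊎-dec
      repetitive? (Cycle n) c 3 (λ j → around (j + toℕ i))

    module _ (wnr : WalkNonrepetitive (Cycle n) c) where

      no-short-square : ∀ t i → 0 < t → t < n → ¬ Square t i
      no-short-square t i 0<t t<n square = around-distinct i 0<t t<n
        (wnr t (λ j → around (j + i)) (λ j _ → around-adjacent (j + i)) square 0 0<t)

      neighbours-differ : 1 < n → ∀ i → c (around i) ≢ c (around (1 + i))
      neighbours-differ 1<n i eq = no-short-square 1 i z<s 1<n λ { 0 _ → eq ; (suc _) (s<s ()) }

      second-neighbours-differ : 2 < n → ∀ i → c (around i) ≢ c (around (2 + i))
      second-neighbours-differ 2<n i eq = around-distinct i z<s 2<n
        (walkNonrepetitive⇒injectiveOnNeighbourhoods (Cycle n) (cycle-symmetric n) c wnr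
          (around (1 + i)) (around i) (cycle-symmetric n (around-adjacent i))
          (around (2 + i)) (around-adjacent (1 + i)) eq)

      obstructed⇒¬walkNonrepetitive : 4 ≤ n → ¬ Obstructed
      obstructed⇒¬walkNonrepetitive 4≤n (i , inj₁ square) =
        no-short-square 1 (toℕ i) z<s (ℕ.<-trans (s<s z<s) 4≤n) square
      obstructed⇒¬walkNonrepetitive 4≤n (i , inj₂ (inj₁ eq)) =
        second-neighbours-differ (ℕ.<-trans (s<s (s<s z<s)) 4≤n) (toℕ i) eq
      obstructed⇒¬walkNonrepetitive 4≤n (i , inj₂ (inj₂ square)) =
        no-short-square 3 (toℕ i) z<s 4≤n square

-- Lower bounds

FourthColourRepeats : ℕ → Set
FourthColourRepeats m =
  ∀ (a b c d : Fin m) → a ≢ b → a ≢ c → b ≢ c → b ≢ d → c ≢ d → a ≡ d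

fourthColourRepeats? : ∀ m → Dec (FourthColourRepeats m)
fourthColourRepeats? m =
  all? λ a → all? λ b → all? λ c → all? λ d →
  ¬? (a ≟ b) →-dec ¬? (a ≟ c) →-dec ¬? (b ≟ c) →-dec ¬? (b ≟ d) →-dec ¬? (c ≟ d) →-dec a ≟ d

fourth-colour-repeats : ∀ {m} → m < 4 → FourthColourRepeats m
fourth-colour-repeats = toWitness {a? = ℕ.allUpTo? fourthColourRepeats? 4} _

fewer-than-four-colours : ∀ {n} → 4 ≤ n → ∀ m → m < 4 → (c : Coloring (Cycle n) m) →
                          ¬ WalkNonrepetitive (Cycle n) c
fewer-than-four-colours {suc n} 4≤n m m<4 c wnr = no-short-square c wnr 3 0 z<s 4≤n
  λ { 0 _ → period-three 0 ; 1 _ → period-three 1 ; 2 _ → period-three 2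
    ; (suc (suc (suc _))) (s<s (s<s (s<s ()))) }
  where
  s : ℕ → Fin m
  s i = c (around i)

  differ₁ : ∀ i → s i ≢ s (1 + i)
  differ₁ = neighbours-differ c wnr (ℕ.<-trans (s<s z<s) 4≤n)

  differ₂ : ∀ i → s i ≢ s (2 + i)
  differ₂ = second-neighbours-differ c wnr (ℕ.<-trans (s<s (s<s z<s)) 4≤n)

  period-three : ∀ i → s i ≡ s (3 + i)
  period-three i = fourth-colour-repeats m<4 (s i) (s (1 + i)) (s (2 + i)) (s (3 + i))
    (differ₁ i) (differ₂ i) (differ₁ (1 + i)) (differ₂ (1 + i)) (differ₁ (2 + i))

four-colourings-obstructed₅ : ∀ (v : Vec (Fin 4) 5) → Obstructed (lookup v)
four-colourings-obstructed₅ = toWitness {a? = allVectors? (obstructed? ∘ lookup)} _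

four-colourings-obstructed₇ : ∀ (v : Vec (Fin 4) 7) → Obstructed (lookup v)
four-colourings-obstructed₇ = toWitness {a? = allVectors? (obstructed? ∘ lookup)} _

no-four-colouring : ∀ {n} .{{_ : NonZero n}} → 4 ≤ n →
                    (∀ (v : Vec (Fin 4) n) → Obstructed (lookup v)) →
                    ∀ (c : Coloring (Cycle n) 4) → ¬ WalkNonrepetitive (Cycle n) c
no-four-colouring {n} 4≤n obstructed c wnr =
  obstructed⇒¬walkNonrepetitive (lookup (tabulate c))
    (walkNonrepetitive-cong (Cycle n) (sym ∘ lookup∘tabulate c) wnr) 4≤n (obstructed (tabulate c))

-- Certified colourings of cycles

module _ {n k : ℕ} (colours : Vec (Fin k) n) (labels : Vec (Vec ℕ n) n) where

  private
    c : Coloring (Cycle n) k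
    c = lookup colours

    lab : Vertex (Cycle n) → Vertex (Cycle n) → ℕ
    lab x y = lookup (lookup labels x) y

  certified :
    {_ : True (injectiveOnNeighbourhoods? (Cycle n) (cycle-adjacent? n) c)}
    {_ : True (invariantLabelling? (Cycle n) (cycle-adjacent? n) c ℕ._≟_ lab)}
    {_ : True (separatingLabelling? (Cycle n) (cycle-adjacent? n) c ℕ._≟_ lab)} →
    Σ (Coloring (Cycle n) k) (WalkNonrepetitive (Cycle n))
  certified {injective} {invariant} {separating} =
    c , labelling⇒walkNonrepetitive (Cycle n) (cycle-symmetric n) c (toWitness injective)
          lab (toWitness invariant) (toWitness separating)

-- Labels number classes of twin pairs closed under parallel steps; pairs that are not twins are
-- never consulted and carry the label 0.

colours₄ : Vec (Fin 4) 4
colours₄ = # 0 ∷ # 1 ∷ # 2 ∷ # 3 ∷ []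

colours₅ : Vec (Fin 5) 5
colours₅ = # 0 ∷ # 1 ∷ # 2 ∷ # 3 ∷ # 4 ∷ []

colours₆ : Vec (Fin 4) 6
colours₆ = # 0 ∷ # 1 ∷ # 2 ∷ # 0 ∷ # 1 ∷ # 3 ∷ []

labels₆ : Vec (Vec ℕ 6) 6
labels₆ =
  (0 ∷ 0 ∷ 0 ∷ 1 ∷ 0 ∷ 0 ∷ []) ∷
  (0 ∷ 0 ∷ 0 ∷ 0 ∷ 1 ∷ 0 ∷ []) ∷
  (0 ∷ 0 ∷ 0 ∷ 0 ∷ 0 ∷ 0 ∷ []) ∷
  (2 ∷ 0 ∷ 0 ∷ 0 ∷ 0 ∷ 0 ∷ []) ∷
  (0 ∷ 2 ∷ 0 ∷ 0 ∷ 0 ∷ 0 ∷ []) ∷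
  (0 ∷ 0 ∷ 0 ∷ 0 ∷ 0 ∷ 0 ∷ []) ∷
  []

colours₇ : Vec (Fin 5) 7
colours₇ = # 0 ∷ # 1 ∷ # 2 ∷ # 0 ∷ # 1 ∷ # 3 ∷ # 4 ∷ []

labels₇ : Vec (Vec ℕ 7) 7
labels₇ =
  (0 ∷ 0 ∷ 0 ∷ 1 ∷ 0 ∷ 0 ∷ 0 ∷ []) ∷
  (0 ∷ 0 ∷ 0 ∷ 0 ∷ 1 ∷ 0 ∷ 0 ∷ []) ∷
  (0 ∷ 0 ∷ 0 ∷ 0 ∷ 0 ∷ 0 ∷ 0 ∷ []) ∷
  (2 ∷ 0 ∷ 0 ∷ 0 ∷ 0 ∷ 0 ∷ 0 ∷ []) ∷
  (0 ∷ 2 ∷ 0 ∷ 0 ∷ 0 ∷ 0 ∷ 0 ∷ []) ∷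
  (0 ∷ 0 ∷ 0 ∷ 0 ∷ 0 ∷ 0 ∷ 0 ∷ []) ∷
  (0 ∷ 0 ∷ 0 ∷ 0 ∷ 0 ∷ 0 ∷ 0 ∷ []) ∷
  []

colours₈ : Vec (Fin 4) 8
colours₈ = # 0 ∷ # 1 ∷ # 2 ∷ # 0 ∷ # 3 ∷ # 1 ∷ # 2 ∷ # 3 ∷ []

labels₈ : Vec (Vec ℕ 8) 8
labels₈ =
  (0 ∷ 0 ∷ 0 ∷ 1 ∷ 0 ∷ 0 ∷ 0 ∷ 0 ∷ []) ∷
  (0 ∷ 0 ∷ 0 ∷ 0 ∷ 0 ∷ 2 ∷ 0 ∷ 0 ∷ []) ∷
  (0 ∷ 0 ∷ 0 ∷ 0 ∷ 0 ∷ 0 ∷ 2 ∷ 0 ∷ []) ∷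
  (3 ∷ 0 ∷ 0 ∷ 0 ∷ 0 ∷ 0 ∷ 0 ∷ 0 ∷ []) ∷
  (0 ∷ 0 ∷ 0 ∷ 0 ∷ 0 ∷ 0 ∷ 0 ∷ 3 ∷ []) ∷
  (0 ∷ 4 ∷ 0 ∷ 0 ∷ 0 ∷ 0 ∷ 0 ∷ 0 ∷ []) ∷
  (0 ∷ 0 ∷ 4 ∷ 0 ∷ 0 ∷ 0 ∷ 0 ∷ 0 ∷ []) ∷
  (0 ∷ 0 ∷ 0 ∷ 0 ∷ 1 ∷ 0 ∷ 0 ∷ 0 ∷ []) ∷
  []

colours₉ : Vec (Fin 4) 9
colours₉ = # 0 ∷ # 1 ∷ # 2 ∷ # 0 ∷ # 1 ∷ # 3 ∷ # 0 ∷ # 2 ∷ # 3 ∷ []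

labels₉ : Vec (Vec ℕ 9) 9
labels₉ =
  (0 ∷ 0 ∷ 0 ∷ 1 ∷ 0 ∷ 0 ∷ 2 ∷ 0 ∷ 0 ∷ []) ∷
  (0 ∷ 0 ∷ 0 ∷ 0 ∷ 1 ∷ 0 ∷ 0 ∷ 0 ∷ 0 ∷ []) ∷
  (0 ∷ 0 ∷ 0 ∷ 0 ∷ 0 ∷ 0 ∷ 0 ∷ 3 ∷ 0 ∷ []) ∷
  (4 ∷ 0 ∷ 0 ∷ 0 ∷ 0 ∷ 0 ∷ 3 ∷ 0 ∷ 0 ∷ []) ∷
  (0 ∷ 4 ∷ 0 ∷ 0 ∷ 0 ∷ 0 ∷ 0 ∷ 0 ∷ 0 ∷ []) ∷
  (0 ∷ 0 ∷ 0 ∷ 0 ∷ 0 ∷ 0 ∷ 0 ∷ 0 ∷ 5 ∷ []) ∷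
  (5 ∷ 0 ∷ 0 ∷ 6 ∷ 0 ∷ 0 ∷ 0 ∷ 0 ∷ 0 ∷ []) ∷
  (0 ∷ 0 ∷ 6 ∷ 0 ∷ 0 ∷ 0 ∷ 0 ∷ 0 ∷ 0 ∷ []) ∷
  (0 ∷ 0 ∷ 0 ∷ 0 ∷ 0 ∷ 2 ∷ 0 ∷ 0 ∷ 0 ∷ []) ∷
  []

colours₁₀ : Vec (Fin 4) 10
colours₁₀ = # 0 ∷ # 1 ∷ # 2 ∷ # 0 ∷ # 1 ∷ # 3 ∷ # 0 ∷ # 2 ∷ # 1 ∷ # 3 ∷ []

labels₁₀ : Vec (Vec ℕ 10) 10
labels₁₀ =
  (0 ∷ 0 ∷ 0 ∷ 1 ∷ 0 ∷ 0 ∷ 2 ∷ 0 ∷ 0 ∷ 0 ∷ []) ∷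
  (0 ∷ 0 ∷ 0 ∷ 0 ∷ 1 ∷ 0 ∷ 0 ∷ 0 ∷ 3 ∷ 0 ∷ []) ∷
  (0 ∷ 0 ∷ 0 ∷ 0 ∷ 0 ∷ 0 ∷ 0 ∷ 3 ∷ 0 ∷ 0 ∷ []) ∷
  (4 ∷ 0 ∷ 0 ∷ 0 ∷ 0 ∷ 0 ∷ 3 ∷ 0 ∷ 0 ∷ 0 ∷ []) ∷
  (0 ∷ 4 ∷ 0 ∷ 0 ∷ 0 ∷ 0 ∷ 0 ∷ 0 ∷ 5 ∷ 0 ∷ []) ∷
  (0 ∷ 0 ∷ 0 ∷ 0 ∷ 0 ∷ 0 ∷ 0 ∷ 0 ∷ 0 ∷ 5 ∷ []) ∷
  (5 ∷ 0 ∷ 0 ∷ 6 ∷ 0 ∷ 0 ∷ 0 ∷ 0 ∷ 0 ∷ 0 ∷ []) ∷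
  (0 ∷ 0 ∷ 6 ∷ 0 ∷ 0 ∷ 0 ∷ 0 ∷ 0 ∷ 0 ∷ 0 ∷ []) ∷
  (0 ∷ 6 ∷ 0 ∷ 0 ∷ 2 ∷ 0 ∷ 0 ∷ 0 ∷ 0 ∷ 0 ∷ []) ∷
  (0 ∷ 0 ∷ 0 ∷ 0 ∷ 0 ∷ 2 ∷ 0 ∷ 0 ∷ 0 ∷ 0 ∷ []) ∷
  []

colours₁₁ : Vec (Fin 4) 11
colours₁₁ = # 0 ∷ # 1 ∷ # 2 ∷ # 0 ∷ # 1 ∷ # 3 ∷ # 2 ∷ # 0 ∷ # 1 ∷ # 2 ∷ # 3 ∷ []

labels₁₁ : Vec (Vec ℕ 11) 11
labels₁₁ =
  (0 ∷ 0 ∷ 0 ∷ 1 ∷ 0 ∷ 0 ∷ 0 ∷ 2 ∷ 0 ∷ 0 ∷ 0 ∷ []) ∷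
  (0 ∷ 0 ∷ 0 ∷ 0 ∷ 1 ∷ 0 ∷ 0 ∷ 0 ∷ 2 ∷ 0 ∷ 0 ∷ []) ∷
  (0 ∷ 0 ∷ 0 ∷ 0 ∷ 0 ∷ 0 ∷ 3 ∷ 0 ∷ 0 ∷ 2 ∷ 0 ∷ []) ∷
  (4 ∷ 0 ∷ 0 ∷ 0 ∷ 0 ∷ 0 ∷ 0 ∷ 3 ∷ 0 ∷ 0 ∷ 0 ∷ []) ∷
  (0 ∷ 4 ∷ 0 ∷ 0 ∷ 0 ∷ 0 ∷ 0 ∷ 0 ∷ 3 ∷ 0 ∷ 0 ∷ []) ∷
  (0 ∷ 0 ∷ 0 ∷ 0 ∷ 0 ∷ 0 ∷ 0 ∷ 0 ∷ 0 ∷ 0 ∷ 5 ∷ []) ∷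
  (0 ∷ 0 ∷ 6 ∷ 0 ∷ 0 ∷ 0 ∷ 0 ∷ 0 ∷ 0 ∷ 5 ∷ 0 ∷ []) ∷
  (7 ∷ 0 ∷ 0 ∷ 6 ∷ 0 ∷ 0 ∷ 0 ∷ 0 ∷ 0 ∷ 0 ∷ 0 ∷ []) ∷
  (0 ∷ 7 ∷ 0 ∷ 0 ∷ 6 ∷ 0 ∷ 0 ∷ 0 ∷ 0 ∷ 0 ∷ 0 ∷ []) ∷
  (0 ∷ 0 ∷ 7 ∷ 0 ∷ 0 ∷ 0 ∷ 8 ∷ 0 ∷ 0 ∷ 0 ∷ 0 ∷ []) ∷
  (0 ∷ 0 ∷ 0 ∷ 0 ∷ 0 ∷ 8 ∷ 0 ∷ 0 ∷ 0 ∷ 0 ∷ 0 ∷ []) ∷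
  []

colours₁₂ : Vec (Fin 4) 12
colours₁₂ = # 0 ∷ # 1 ∷ # 2 ∷ # 0 ∷ # 1 ∷ # 3 ∷ # 0 ∷ # 2 ∷ # 1 ∷ # 0 ∷ # 2 ∷ # 3 ∷ []

labels₁₂ : Vec (Vec ℕ 12) 12
labels₁₂ =
  (0 ∷ 0 ∷ 0 ∷ 1 ∷ 0 ∷ 0 ∷ 2 ∷ 0 ∷ 0 ∷ 3 ∷ 0 ∷ 0 ∷ []) ∷
  (0 ∷ 0 ∷ 0 ∷ 0 ∷ 1 ∷ 0 ∷ 0 ∷ 0 ∷ 3 ∷ 0 ∷ 0 ∷ 0 ∷ []) ∷
  (0 ∷ 0 ∷ 0 ∷ 0 ∷ 0 ∷ 0 ∷ 0 ∷ 3 ∷ 0 ∷ 0 ∷ 4 ∷ 0 ∷ []) ∷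
  (5 ∷ 0 ∷ 0 ∷ 0 ∷ 0 ∷ 0 ∷ 3 ∷ 0 ∷ 0 ∷ 4 ∷ 0 ∷ 0 ∷ []) ∷
  (0 ∷ 5 ∷ 0 ∷ 0 ∷ 0 ∷ 0 ∷ 0 ∷ 0 ∷ 4 ∷ 0 ∷ 0 ∷ 0 ∷ []) ∷
  (0 ∷ 0 ∷ 0 ∷ 0 ∷ 0 ∷ 0 ∷ 0 ∷ 0 ∷ 0 ∷ 0 ∷ 0 ∷ 6 ∷ []) ∷
  (6 ∷ 0 ∷ 0 ∷ 7 ∷ 0 ∷ 0 ∷ 0 ∷ 0 ∷ 0 ∷ 8 ∷ 0 ∷ 0 ∷ []) ∷
  (0 ∷ 0 ∷ 7 ∷ 0 ∷ 0 ∷ 0 ∷ 0 ∷ 0 ∷ 0 ∷ 0 ∷ 8 ∷ 0 ∷ []) ∷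
  (0 ∷ 7 ∷ 0 ∷ 0 ∷ 9 ∷ 0 ∷ 0 ∷ 0 ∷ 0 ∷ 0 ∷ 0 ∷ 0 ∷ []) ∷
  (7 ∷ 0 ∷ 0 ∷ 9 ∷ 0 ∷ 0 ∷ 10 ∷ 0 ∷ 0 ∷ 0 ∷ 0 ∷ 0 ∷ []) ∷
  (0 ∷ 0 ∷ 9 ∷ 0 ∷ 0 ∷ 0 ∷ 0 ∷ 10 ∷ 0 ∷ 0 ∷ 0 ∷ 0 ∷ []) ∷
  (0 ∷ 0 ∷ 0 ∷ 0 ∷ 0 ∷ 2 ∷ 0 ∷ 0 ∷ 0 ∷ 0 ∷ 0 ∷ 0 ∷ []) ∷
  []

colours₁₃ : Vec (Fin 4) 13
colours₁₃ = # 0 ∷ # 1 ∷ # 2 ∷ # 0 ∷ # 1 ∷ # 3 ∷ # 0 ∷ # 2 ∷ # 3 ∷ # 1 ∷ # 0 ∷ # 2 ∷ # 3 ∷ []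

labels₁₃ : Vec (Vec ℕ 13) 13
labels₁₃ =
  (0 ∷ 0 ∷ 0 ∷ 1 ∷ 0 ∷ 0 ∷ 2 ∷ 0 ∷ 0 ∷ 0 ∷ 3 ∷ 0 ∷ 0 ∷ []) ∷
  (0 ∷ 0 ∷ 0 ∷ 0 ∷ 1 ∷ 0 ∷ 0 ∷ 0 ∷ 0 ∷ 3 ∷ 0 ∷ 0 ∷ 0 ∷ []) ∷
  (0 ∷ 0 ∷ 0 ∷ 0 ∷ 0 ∷ 0 ∷ 0 ∷ 4 ∷ 0 ∷ 0 ∷ 0 ∷ 5 ∷ 0 ∷ []) ∷
  (6 ∷ 0 ∷ 0 ∷ 0 ∷ 0 ∷ 0 ∷ 4 ∷ 0 ∷ 0 ∷ 0 ∷ 5 ∷ 0 ∷ 0 ∷ []) ∷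
  (0 ∷ 6 ∷ 0 ∷ 0 ∷ 0 ∷ 0 ∷ 0 ∷ 0 ∷ 0 ∷ 5 ∷ 0 ∷ 0 ∷ 0 ∷ []) ∷
  (0 ∷ 0 ∷ 0 ∷ 0 ∷ 0 ∷ 0 ∷ 0 ∷ 0 ∷ 5 ∷ 0 ∷ 0 ∷ 0 ∷ 7 ∷ []) ∷
  (7 ∷ 0 ∷ 0 ∷ 8 ∷ 0 ∷ 0 ∷ 0 ∷ 0 ∷ 0 ∷ 0 ∷ 9 ∷ 0 ∷ 0 ∷ []) ∷
  (0 ∷ 0 ∷ 8 ∷ 0 ∷ 0 ∷ 0 ∷ 0 ∷ 0 ∷ 0 ∷ 0 ∷ 0 ∷ 9 ∷ 0 ∷ []) ∷
  (0 ∷ 0 ∷ 0 ∷ 0 ∷ 0 ∷ 10 ∷ 0 ∷ 0 ∷ 0 ∷ 0 ∷ 0 ∷ 0 ∷ 9 ∷ []) ∷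
  (0 ∷ 11 ∷ 0 ∷ 0 ∷ 10 ∷ 0 ∷ 0 ∷ 0 ∷ 0 ∷ 0 ∷ 0 ∷ 0 ∷ 0 ∷ []) ∷
  (11 ∷ 0 ∷ 0 ∷ 10 ∷ 0 ∷ 0 ∷ 12 ∷ 0 ∷ 0 ∷ 0 ∷ 0 ∷ 0 ∷ 0 ∷ []) ∷
  (0 ∷ 0 ∷ 10 ∷ 0 ∷ 0 ∷ 0 ∷ 0 ∷ 12 ∷ 0 ∷ 0 ∷ 0 ∷ 0 ∷ 0 ∷ []) ∷
  (0 ∷ 0 ∷ 0 ∷ 0 ∷ 0 ∷ 2 ∷ 0 ∷ 0 ∷ 12 ∷ 0 ∷ 0 ∷ 0 ∷ 0 ∷ []) ∷
  []

colours₁₄ : Vec (Fin 4) 14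
colours₁₄ = # 0 ∷ # 1 ∷ # 2 ∷ # 0 ∷ # 1 ∷ # 3 ∷ # 0 ∷ # 1 ∷ # 2 ∷ # 0 ∷ # 3 ∷ # 1 ∷ # 2 ∷ # 3 ∷ []

labels₁₄ : Vec (Vec ℕ 14) 14
labels₁₄ =
  (0 ∷ 0 ∷ 0 ∷ 1 ∷ 0 ∷ 0 ∷ 2 ∷ 0 ∷ 0 ∷ 3 ∷ 0 ∷ 0 ∷ 0 ∷ 0 ∷ []) ∷
  (0 ∷ 0 ∷ 0 ∷ 0 ∷ 1 ∷ 0 ∷ 0 ∷ 2 ∷ 0 ∷ 0 ∷ 0 ∷ 4 ∷ 0 ∷ 0 ∷ []) ∷
  (0 ∷ 0 ∷ 0 ∷ 0 ∷ 0 ∷ 0 ∷ 0 ∷ 0 ∷ 2 ∷ 0 ∷ 0 ∷ 0 ∷ 4 ∷ 0 ∷ []) ∷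
  (5 ∷ 0 ∷ 0 ∷ 0 ∷ 0 ∷ 0 ∷ 6 ∷ 0 ∷ 0 ∷ 2 ∷ 0 ∷ 0 ∷ 0 ∷ 0 ∷ []) ∷
  (0 ∷ 5 ∷ 0 ∷ 0 ∷ 0 ∷ 0 ∷ 0 ∷ 6 ∷ 0 ∷ 0 ∷ 0 ∷ 7 ∷ 0 ∷ 0 ∷ []) ∷
  (0 ∷ 0 ∷ 0 ∷ 0 ∷ 0 ∷ 0 ∷ 0 ∷ 0 ∷ 0 ∷ 0 ∷ 7 ∷ 0 ∷ 0 ∷ 8 ∷ []) ∷
  (8 ∷ 0 ∷ 0 ∷ 9 ∷ 0 ∷ 0 ∷ 0 ∷ 0 ∷ 0 ∷ 7 ∷ 0 ∷ 0 ∷ 0 ∷ 0 ∷ []) ∷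
  (0 ∷ 8 ∷ 0 ∷ 0 ∷ 9 ∷ 0 ∷ 0 ∷ 0 ∷ 0 ∷ 0 ∷ 0 ∷ 10 ∷ 0 ∷ 0 ∷ []) ∷
  (0 ∷ 0 ∷ 8 ∷ 0 ∷ 0 ∷ 0 ∷ 0 ∷ 0 ∷ 0 ∷ 0 ∷ 0 ∷ 0 ∷ 10 ∷ 0 ∷ []) ∷
  (11 ∷ 0 ∷ 0 ∷ 8 ∷ 0 ∷ 0 ∷ 12 ∷ 0 ∷ 0 ∷ 0 ∷ 0 ∷ 0 ∷ 0 ∷ 0 ∷ []) ∷
  (0 ∷ 0 ∷ 0 ∷ 0 ∷ 0 ∷ 12 ∷ 0 ∷ 0 ∷ 0 ∷ 0 ∷ 0 ∷ 0 ∷ 0 ∷ 11 ∷ []) ∷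
  (0 ∷ 13 ∷ 0 ∷ 0 ∷ 12 ∷ 0 ∷ 0 ∷ 14 ∷ 0 ∷ 0 ∷ 0 ∷ 0 ∷ 0 ∷ 0 ∷ []) ∷
  (0 ∷ 0 ∷ 13 ∷ 0 ∷ 0 ∷ 0 ∷ 0 ∷ 0 ∷ 14 ∷ 0 ∷ 0 ∷ 0 ∷ 0 ∷ 0 ∷ []) ∷
  (0 ∷ 0 ∷ 0 ∷ 0 ∷ 0 ∷ 2 ∷ 0 ∷ 0 ∷ 0 ∷ 0 ∷ 3 ∷ 0 ∷ 0 ∷ 0 ∷ []) ∷
  []

colours₁₅ : Vec (Fin 4) 15
colours₁₅ = # 0 ∷ # 1 ∷ # 2 ∷ # 0 ∷ # 1 ∷ # 3 ∷ # 0 ∷ # 1 ∷ # 2 ∷ # 0 ∷ # 3 ∷ # 1 ∷ # 0 ∷ # 2 ∷ # 3 ∷ []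

labels₁₅ : Vec (Vec ℕ 15) 15
labels₁₅ =
  (0 ∷ 0 ∷ 0 ∷ 1 ∷ 0 ∷ 0 ∷ 2 ∷ 0 ∷ 0 ∷ 3 ∷ 0 ∷ 0 ∷ 4 ∷ 0 ∷ 0 ∷ []) ∷
  (0 ∷ 0 ∷ 0 ∷ 0 ∷ 1 ∷ 0 ∷ 0 ∷ 2 ∷ 0 ∷ 0 ∷ 0 ∷ 4 ∷ 0 ∷ 0 ∷ 0 ∷ []) ∷
  (0 ∷ 0 ∷ 0 ∷ 0 ∷ 0 ∷ 0 ∷ 0 ∷ 0 ∷ 2 ∷ 0 ∷ 0 ∷ 0 ∷ 0 ∷ 5 ∷ 0 ∷ []) ∷
  (6 ∷ 0 ∷ 0 ∷ 0 ∷ 0 ∷ 0 ∷ 7 ∷ 0 ∷ 0 ∷ 2 ∷ 0 ∷ 0 ∷ 5 ∷ 0 ∷ 0 ∷ []) ∷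
  (0 ∷ 6 ∷ 0 ∷ 0 ∷ 0 ∷ 0 ∷ 0 ∷ 7 ∷ 0 ∷ 0 ∷ 0 ∷ 5 ∷ 0 ∷ 0 ∷ 0 ∷ []) ∷
  (0 ∷ 0 ∷ 0 ∷ 0 ∷ 0 ∷ 0 ∷ 0 ∷ 0 ∷ 0 ∷ 0 ∷ 5 ∷ 0 ∷ 0 ∷ 0 ∷ 8 ∷ []) ∷
  (8 ∷ 0 ∷ 0 ∷ 9 ∷ 0 ∷ 0 ∷ 0 ∷ 0 ∷ 0 ∷ 5 ∷ 0 ∷ 0 ∷ 10 ∷ 0 ∷ 0 ∷ []) ∷
  (0 ∷ 8 ∷ 0 ∷ 0 ∷ 9 ∷ 0 ∷ 0 ∷ 0 ∷ 0 ∷ 0 ∷ 0 ∷ 10 ∷ 0 ∷ 0 ∷ 0 ∷ []) ∷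
  (0 ∷ 0 ∷ 8 ∷ 0 ∷ 0 ∷ 0 ∷ 0 ∷ 0 ∷ 0 ∷ 0 ∷ 0 ∷ 0 ∷ 0 ∷ 11 ∷ 0 ∷ []) ∷
  (12 ∷ 0 ∷ 0 ∷ 8 ∷ 0 ∷ 0 ∷ 13 ∷ 0 ∷ 0 ∷ 0 ∷ 0 ∷ 0 ∷ 11 ∷ 0 ∷ 0 ∷ []) ∷
  (0 ∷ 0 ∷ 0 ∷ 0 ∷ 0 ∷ 13 ∷ 0 ∷ 0 ∷ 0 ∷ 0 ∷ 0 ∷ 0 ∷ 0 ∷ 0 ∷ 12 ∷ []) ∷
  (0 ∷ 14 ∷ 0 ∷ 0 ∷ 13 ∷ 0 ∷ 0 ∷ 15 ∷ 0 ∷ 0 ∷ 0 ∷ 0 ∷ 0 ∷ 0 ∷ 0 ∷ []) ∷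
  (14 ∷ 0 ∷ 0 ∷ 13 ∷ 0 ∷ 0 ∷ 15 ∷ 0 ∷ 0 ∷ 16 ∷ 0 ∷ 0 ∷ 0 ∷ 0 ∷ 0 ∷ []) ∷
  (0 ∷ 0 ∷ 13 ∷ 0 ∷ 0 ∷ 0 ∷ 0 ∷ 0 ∷ 16 ∷ 0 ∷ 0 ∷ 0 ∷ 0 ∷ 0 ∷ 0 ∷ []) ∷
  (0 ∷ 0 ∷ 0 ∷ 0 ∷ 0 ∷ 2 ∷ 0 ∷ 0 ∷ 0 ∷ 0 ∷ 3 ∷ 0 ∷ 0 ∷ 0 ∷ 0 ∷ []) ∷
  []

colours₁₆ : Vec (Fin 4) 16
colours₁₆ = # 0 ∷ # 1 ∷ # 2 ∷ # 0 ∷ # 1 ∷ # 3 ∷ # 0 ∷ # 1 ∷ # 2 ∷ # 0 ∷ # 3 ∷ # 2 ∷ # 0 ∷ # 1 ∷ # 2 ∷ # 3 ∷ []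

labels₁₆ : Vec (Vec ℕ 16) 16
labels₁₆ =
  (0 ∷ 0 ∷ 0 ∷ 1 ∷ 0 ∷ 0 ∷ 2 ∷ 0 ∷ 0 ∷ 3 ∷ 0 ∷ 0 ∷ 4 ∷ 0 ∷ 0 ∷ 0 ∷ []) ∷
  (0 ∷ 0 ∷ 0 ∷ 0 ∷ 1 ∷ 0 ∷ 0 ∷ 2 ∷ 0 ∷ 0 ∷ 0 ∷ 0 ∷ 0 ∷ 4 ∷ 0 ∷ 0 ∷ []) ∷
  (0 ∷ 0 ∷ 0 ∷ 0 ∷ 0 ∷ 0 ∷ 0 ∷ 0 ∷ 2 ∷ 0 ∷ 0 ∷ 5 ∷ 0 ∷ 0 ∷ 4 ∷ 0 ∷ []) ∷
  (6 ∷ 0 ∷ 0 ∷ 0 ∷ 0 ∷ 0 ∷ 7 ∷ 0 ∷ 0 ∷ 2 ∷ 0 ∷ 0 ∷ 5 ∷ 0 ∷ 0 ∷ 0 ∷ []) ∷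
  (0 ∷ 6 ∷ 0 ∷ 0 ∷ 0 ∷ 0 ∷ 0 ∷ 7 ∷ 0 ∷ 0 ∷ 0 ∷ 0 ∷ 0 ∷ 5 ∷ 0 ∷ 0 ∷ []) ∷
  (0 ∷ 0 ∷ 0 ∷ 0 ∷ 0 ∷ 0 ∷ 0 ∷ 0 ∷ 0 ∷ 0 ∷ 8 ∷ 0 ∷ 0 ∷ 0 ∷ 0 ∷ 9 ∷ []) ∷
  (9 ∷ 0 ∷ 0 ∷ 10 ∷ 0 ∷ 0 ∷ 0 ∷ 0 ∷ 0 ∷ 8 ∷ 0 ∷ 0 ∷ 11 ∷ 0 ∷ 0 ∷ 0 ∷ []) ∷
  (0 ∷ 9 ∷ 0 ∷ 0 ∷ 10 ∷ 0 ∷ 0 ∷ 0 ∷ 0 ∷ 0 ∷ 0 ∷ 0 ∷ 0 ∷ 11 ∷ 0 ∷ 0 ∷ []) ∷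
  (0 ∷ 0 ∷ 9 ∷ 0 ∷ 0 ∷ 0 ∷ 0 ∷ 0 ∷ 0 ∷ 0 ∷ 0 ∷ 12 ∷ 0 ∷ 0 ∷ 11 ∷ 0 ∷ []) ∷
  (13 ∷ 0 ∷ 0 ∷ 9 ∷ 0 ∷ 0 ∷ 14 ∷ 0 ∷ 0 ∷ 0 ∷ 0 ∷ 0 ∷ 12 ∷ 0 ∷ 0 ∷ 0 ∷ []) ∷
  (0 ∷ 0 ∷ 0 ∷ 0 ∷ 0 ∷ 14 ∷ 0 ∷ 0 ∷ 0 ∷ 0 ∷ 0 ∷ 0 ∷ 0 ∷ 0 ∷ 0 ∷ 13 ∷ []) ∷
  (0 ∷ 0 ∷ 15 ∷ 0 ∷ 0 ∷ 0 ∷ 0 ∷ 0 ∷ 16 ∷ 0 ∷ 0 ∷ 0 ∷ 0 ∷ 0 ∷ 13 ∷ 0 ∷ []) ∷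
  (17 ∷ 0 ∷ 0 ∷ 15 ∷ 0 ∷ 0 ∷ 18 ∷ 0 ∷ 0 ∷ 16 ∷ 0 ∷ 0 ∷ 0 ∷ 0 ∷ 0 ∷ 0 ∷ []) ∷
  (0 ∷ 17 ∷ 0 ∷ 0 ∷ 15 ∷ 0 ∷ 0 ∷ 18 ∷ 0 ∷ 0 ∷ 0 ∷ 0 ∷ 0 ∷ 0 ∷ 0 ∷ 0 ∷ []) ∷
  (0 ∷ 0 ∷ 17 ∷ 0 ∷ 0 ∷ 0 ∷ 0 ∷ 0 ∷ 18 ∷ 0 ∷ 0 ∷ 3 ∷ 0 ∷ 0 ∷ 0 ∷ 0 ∷ []) ∷
  (0 ∷ 0 ∷ 0 ∷ 0 ∷ 0 ∷ 2 ∷ 0 ∷ 0 ∷ 0 ∷ 0 ∷ 3 ∷ 0 ∷ 0 ∷ 0 ∷ 0 ∷ 0 ∷ []) ∷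
  []

colours₁₇ : Vec (Fin 4) 17
colours₁₇ = # 0 ∷ # 1 ∷ # 2 ∷ # 0 ∷ # 1 ∷ # 3 ∷ # 0 ∷ # 1 ∷ # 2 ∷ # 0 ∷ # 3 ∷ # 1 ∷ # 2 ∷ # 0 ∷ # 1 ∷ # 2 ∷ # 3 ∷ []

labels₁₇ : Vec (Vec ℕ 17) 17
labels₁₇ =
  (0 ∷ 0 ∷ 0 ∷ 1 ∷ 0 ∷ 0 ∷ 2 ∷ 0 ∷ 0 ∷ 3 ∷ 0 ∷ 0 ∷ 0 ∷ 4 ∷ 0 ∷ 0 ∷ 0 ∷ []) ∷
  (0 ∷ 0 ∷ 0 ∷ 0 ∷ 1 ∷ 0 ∷ 0 ∷ 2 ∷ 0 ∷ 0 ∷ 0 ∷ 5 ∷ 0 ∷ 0 ∷ 4 ∷ 0 ∷ 0 ∷ []) ∷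
  (0 ∷ 0 ∷ 0 ∷ 0 ∷ 0 ∷ 0 ∷ 0 ∷ 0 ∷ 2 ∷ 0 ∷ 0 ∷ 0 ∷ 5 ∷ 0 ∷ 0 ∷ 4 ∷ 0 ∷ []) ∷
  (6 ∷ 0 ∷ 0 ∷ 0 ∷ 0 ∷ 0 ∷ 7 ∷ 0 ∷ 0 ∷ 2 ∷ 0 ∷ 0 ∷ 0 ∷ 5 ∷ 0 ∷ 0 ∷ 0 ∷ []) ∷
  (0 ∷ 6 ∷ 0 ∷ 0 ∷ 0 ∷ 0 ∷ 0 ∷ 7 ∷ 0 ∷ 0 ∷ 0 ∷ 8 ∷ 0 ∷ 0 ∷ 5 ∷ 0 ∷ 0 ∷ []) ∷
  (0 ∷ 0 ∷ 0 ∷ 0 ∷ 0 ∷ 0 ∷ 0 ∷ 0 ∷ 0 ∷ 0 ∷ 8 ∷ 0 ∷ 0 ∷ 0 ∷ 0 ∷ 0 ∷ 9 ∷ []) ∷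
  (9 ∷ 0 ∷ 0 ∷ 10 ∷ 0 ∷ 0 ∷ 0 ∷ 0 ∷ 0 ∷ 8 ∷ 0 ∷ 0 ∷ 0 ∷ 11 ∷ 0 ∷ 0 ∷ 0 ∷ []) ∷
  (0 ∷ 9 ∷ 0 ∷ 0 ∷ 10 ∷ 0 ∷ 0 ∷ 0 ∷ 0 ∷ 0 ∷ 0 ∷ 12 ∷ 0 ∷ 0 ∷ 11 ∷ 0 ∷ 0 ∷ []) ∷
  (0 ∷ 0 ∷ 9 ∷ 0 ∷ 0 ∷ 0 ∷ 0 ∷ 0 ∷ 0 ∷ 0 ∷ 0 ∷ 0 ∷ 12 ∷ 0 ∷ 0 ∷ 11 ∷ 0 ∷ []) ∷
  (13 ∷ 0 ∷ 0 ∷ 9 ∷ 0 ∷ 0 ∷ 14 ∷ 0 ∷ 0 ∷ 0 ∷ 0 ∷ 0 ∷ 0 ∷ 12 ∷ 0 ∷ 0 ∷ 0 ∷ []) ∷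
  (0 ∷ 0 ∷ 0 ∷ 0 ∷ 0 ∷ 14 ∷ 0 ∷ 0 ∷ 0 ∷ 0 ∷ 0 ∷ 0 ∷ 0 ∷ 0 ∷ 0 ∷ 0 ∷ 13 ∷ []) ∷
  (0 ∷ 15 ∷ 0 ∷ 0 ∷ 14 ∷ 0 ∷ 0 ∷ 16 ∷ 0 ∷ 0 ∷ 0 ∷ 0 ∷ 0 ∷ 0 ∷ 17 ∷ 0 ∷ 0 ∷ []) ∷
  (0 ∷ 0 ∷ 15 ∷ 0 ∷ 0 ∷ 0 ∷ 0 ∷ 0 ∷ 16 ∷ 0 ∷ 0 ∷ 0 ∷ 0 ∷ 0 ∷ 0 ∷ 17 ∷ 0 ∷ []) ∷
  (18 ∷ 0 ∷ 0 ∷ 15 ∷ 0 ∷ 0 ∷ 19 ∷ 0 ∷ 0 ∷ 16 ∷ 0 ∷ 0 ∷ 0 ∷ 0 ∷ 0 ∷ 0 ∷ 0 ∷ []) ∷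
  (0 ∷ 18 ∷ 0 ∷ 0 ∷ 15 ∷ 0 ∷ 0 ∷ 19 ∷ 0 ∷ 0 ∷ 0 ∷ 20 ∷ 0 ∷ 0 ∷ 0 ∷ 0 ∷ 0 ∷ []) ∷
  (0 ∷ 0 ∷ 18 ∷ 0 ∷ 0 ∷ 0 ∷ 0 ∷ 0 ∷ 19 ∷ 0 ∷ 0 ∷ 0 ∷ 20 ∷ 0 ∷ 0 ∷ 0 ∷ 0 ∷ []) ∷
  (0 ∷ 0 ∷ 0 ∷ 0 ∷ 0 ∷ 2 ∷ 0 ∷ 0 ∷ 0 ∷ 0 ∷ 3 ∷ 0 ∷ 0 ∷ 0 ∷ 0 ∷ 0 ∷ 0 ∷ []) ∷
  []

colours₁₈ : Vec (Fin 4) 18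
colours₁₈ = # 0 ∷ # 1 ∷ # 2 ∷ # 0 ∷ # 1 ∷ # 3 ∷ # 0 ∷ # 1 ∷ # 2 ∷ # 0 ∷ # 3 ∷ # 1 ∷ # 0 ∷ # 2 ∷ # 3 ∷ # 1 ∷ # 2 ∷ # 3 ∷ []

labels₁₈ : Vec (Vec ℕ 18) 18
labels₁₈ =
  (0 ∷ 0 ∷ 0 ∷ 1 ∷ 0 ∷ 0 ∷ 2 ∷ 0 ∷ 0 ∷ 3 ∷ 0 ∷ 0 ∷ 4 ∷ 0 ∷ 0 ∷ 0 ∷ 0 ∷ 0 ∷ []) ∷
  (0 ∷ 0 ∷ 0 ∷ 0 ∷ 1 ∷ 0 ∷ 0 ∷ 2 ∷ 0 ∷ 0 ∷ 0 ∷ 4 ∷ 0 ∷ 0 ∷ 0 ∷ 5 ∷ 0 ∷ 0 ∷ []) ∷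
  (0 ∷ 0 ∷ 0 ∷ 0 ∷ 0 ∷ 0 ∷ 0 ∷ 0 ∷ 2 ∷ 0 ∷ 0 ∷ 0 ∷ 0 ∷ 6 ∷ 0 ∷ 0 ∷ 5 ∷ 0 ∷ []) ∷
  (7 ∷ 0 ∷ 0 ∷ 0 ∷ 0 ∷ 0 ∷ 8 ∷ 0 ∷ 0 ∷ 2 ∷ 0 ∷ 0 ∷ 6 ∷ 0 ∷ 0 ∷ 0 ∷ 0 ∷ 0 ∷ []) ∷
  (0 ∷ 7 ∷ 0 ∷ 0 ∷ 0 ∷ 0 ∷ 0 ∷ 8 ∷ 0 ∷ 0 ∷ 0 ∷ 6 ∷ 0 ∷ 0 ∷ 0 ∷ 9 ∷ 0 ∷ 0 ∷ []) ∷
  (0 ∷ 0 ∷ 0 ∷ 0 ∷ 0 ∷ 0 ∷ 0 ∷ 0 ∷ 0 ∷ 0 ∷ 6 ∷ 0 ∷ 0 ∷ 0 ∷ 9 ∷ 0 ∷ 0 ∷ 10 ∷ []) ∷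
  (10 ∷ 0 ∷ 0 ∷ 11 ∷ 0 ∷ 0 ∷ 0 ∷ 0 ∷ 0 ∷ 6 ∷ 0 ∷ 0 ∷ 12 ∷ 0 ∷ 0 ∷ 0 ∷ 0 ∷ 0 ∷ []) ∷
  (0 ∷ 10 ∷ 0 ∷ 0 ∷ 11 ∷ 0 ∷ 0 ∷ 0 ∷ 0 ∷ 0 ∷ 0 ∷ 12 ∷ 0 ∷ 0 ∷ 0 ∷ 13 ∷ 0 ∷ 0 ∷ []) ∷
  (0 ∷ 0 ∷ 10 ∷ 0 ∷ 0 ∷ 0 ∷ 0 ∷ 0 ∷ 0 ∷ 0 ∷ 0 ∷ 0 ∷ 0 ∷ 14 ∷ 0 ∷ 0 ∷ 13 ∷ 0 ∷ []) ∷
  (15 ∷ 0 ∷ 0 ∷ 10 ∷ 0 ∷ 0 ∷ 16 ∷ 0 ∷ 0 ∷ 0 ∷ 0 ∷ 0 ∷ 14 ∷ 0 ∷ 0 ∷ 0 ∷ 0 ∷ 0 ∷ []) ∷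
  (0 ∷ 0 ∷ 0 ∷ 0 ∷ 0 ∷ 16 ∷ 0 ∷ 0 ∷ 0 ∷ 0 ∷ 0 ∷ 0 ∷ 0 ∷ 0 ∷ 17 ∷ 0 ∷ 0 ∷ 15 ∷ []) ∷
  (0 ∷ 18 ∷ 0 ∷ 0 ∷ 16 ∷ 0 ∷ 0 ∷ 19 ∷ 0 ∷ 0 ∷ 0 ∷ 0 ∷ 0 ∷ 0 ∷ 0 ∷ 17 ∷ 0 ∷ 0 ∷ []) ∷
  (18 ∷ 0 ∷ 0 ∷ 16 ∷ 0 ∷ 0 ∷ 19 ∷ 0 ∷ 0 ∷ 20 ∷ 0 ∷ 0 ∷ 0 ∷ 0 ∷ 0 ∷ 0 ∷ 0 ∷ 0 ∷ []) ∷
  (0 ∷ 0 ∷ 16 ∷ 0 ∷ 0 ∷ 0 ∷ 0 ∷ 0 ∷ 20 ∷ 0 ∷ 0 ∷ 0 ∷ 0 ∷ 0 ∷ 0 ∷ 0 ∷ 21 ∷ 0 ∷ []) ∷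
  (0 ∷ 0 ∷ 0 ∷ 0 ∷ 0 ∷ 22 ∷ 0 ∷ 0 ∷ 0 ∷ 0 ∷ 23 ∷ 0 ∷ 0 ∷ 0 ∷ 0 ∷ 0 ∷ 0 ∷ 21 ∷ []) ∷
  (0 ∷ 24 ∷ 0 ∷ 0 ∷ 22 ∷ 0 ∷ 0 ∷ 25 ∷ 0 ∷ 0 ∷ 0 ∷ 23 ∷ 0 ∷ 0 ∷ 0 ∷ 0 ∷ 0 ∷ 0 ∷ []) ∷
  (0 ∷ 0 ∷ 24 ∷ 0 ∷ 0 ∷ 0 ∷ 0 ∷ 0 ∷ 25 ∷ 0 ∷ 0 ∷ 0 ∷ 0 ∷ 26 ∷ 0 ∷ 0 ∷ 0 ∷ 0 ∷ []) ∷
  (0 ∷ 0 ∷ 0 ∷ 0 ∷ 0 ∷ 2 ∷ 0 ∷ 0 ∷ 0 ∷ 0 ∷ 3 ∷ 0 ∷ 0 ∷ 0 ∷ 26 ∷ 0 ∷ 0 ∷ 0 ∷ []) ∷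
  []

colours₁₉ : Vec (Fin 4) 19
colours₁₉ = # 0 ∷ # 1 ∷ # 2 ∷ # 0 ∷ # 1 ∷ # 3 ∷ # 0 ∷ # 1 ∷ # 2 ∷ # 0 ∷ # 3 ∷ # 1 ∷ # 0 ∷ # 2 ∷ # 1 ∷ # 3 ∷ # 0 ∷ # 2 ∷ # 3 ∷ []

labels₁₉ : Vec (Vec ℕ 19) 19
labels₁₉ =
  (0 ∷ 0 ∷ 0 ∷ 1 ∷ 0 ∷ 0 ∷ 2 ∷ 0 ∷ 0 ∷ 3 ∷ 0 ∷ 0 ∷ 4 ∷ 0 ∷ 0 ∷ 0 ∷ 5 ∷ 0 ∷ 0 ∷ []) ∷
  (0 ∷ 0 ∷ 0 ∷ 0 ∷ 1 ∷ 0 ∷ 0 ∷ 2 ∷ 0 ∷ 0 ∷ 0 ∷ 4 ∷ 0 ∷ 0 ∷ 6 ∷ 0 ∷ 0 ∷ 0 ∷ 0 ∷ []) ∷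
  (0 ∷ 0 ∷ 0 ∷ 0 ∷ 0 ∷ 0 ∷ 0 ∷ 0 ∷ 2 ∷ 0 ∷ 0 ∷ 0 ∷ 0 ∷ 6 ∷ 0 ∷ 0 ∷ 0 ∷ 7 ∷ 0 ∷ []) ∷
  (8 ∷ 0 ∷ 0 ∷ 0 ∷ 0 ∷ 0 ∷ 9 ∷ 0 ∷ 0 ∷ 2 ∷ 0 ∷ 0 ∷ 6 ∷ 0 ∷ 0 ∷ 0 ∷ 7 ∷ 0 ∷ 0 ∷ []) ∷
  (0 ∷ 8 ∷ 0 ∷ 0 ∷ 0 ∷ 0 ∷ 0 ∷ 9 ∷ 0 ∷ 0 ∷ 0 ∷ 6 ∷ 0 ∷ 0 ∷ 10 ∷ 0 ∷ 0 ∷ 0 ∷ 0 ∷ []) ∷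
  (0 ∷ 0 ∷ 0 ∷ 0 ∷ 0 ∷ 0 ∷ 0 ∷ 0 ∷ 0 ∷ 0 ∷ 6 ∷ 0 ∷ 0 ∷ 0 ∷ 0 ∷ 10 ∷ 0 ∷ 0 ∷ 11 ∷ []) ∷
  (11 ∷ 0 ∷ 0 ∷ 12 ∷ 0 ∷ 0 ∷ 0 ∷ 0 ∷ 0 ∷ 6 ∷ 0 ∷ 0 ∷ 13 ∷ 0 ∷ 0 ∷ 0 ∷ 10 ∷ 0 ∷ 0 ∷ []) ∷
  (0 ∷ 11 ∷ 0 ∷ 0 ∷ 12 ∷ 0 ∷ 0 ∷ 0 ∷ 0 ∷ 0 ∷ 0 ∷ 13 ∷ 0 ∷ 0 ∷ 14 ∷ 0 ∷ 0 ∷ 0 ∷ 0 ∷ []) ∷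
  (0 ∷ 0 ∷ 11 ∷ 0 ∷ 0 ∷ 0 ∷ 0 ∷ 0 ∷ 0 ∷ 0 ∷ 0 ∷ 0 ∷ 0 ∷ 14 ∷ 0 ∷ 0 ∷ 0 ∷ 15 ∷ 0 ∷ []) ∷
  (16 ∷ 0 ∷ 0 ∷ 11 ∷ 0 ∷ 0 ∷ 17 ∷ 0 ∷ 0 ∷ 0 ∷ 0 ∷ 0 ∷ 14 ∷ 0 ∷ 0 ∷ 0 ∷ 15 ∷ 0 ∷ 0 ∷ []) ∷
  (0 ∷ 0 ∷ 0 ∷ 0 ∷ 0 ∷ 17 ∷ 0 ∷ 0 ∷ 0 ∷ 0 ∷ 0 ∷ 0 ∷ 0 ∷ 0 ∷ 0 ∷ 15 ∷ 0 ∷ 0 ∷ 16 ∷ []) ∷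
  (0 ∷ 18 ∷ 0 ∷ 0 ∷ 17 ∷ 0 ∷ 0 ∷ 19 ∷ 0 ∷ 0 ∷ 0 ∷ 0 ∷ 0 ∷ 0 ∷ 15 ∷ 0 ∷ 0 ∷ 0 ∷ 0 ∷ []) ∷
  (18 ∷ 0 ∷ 0 ∷ 17 ∷ 0 ∷ 0 ∷ 19 ∷ 0 ∷ 0 ∷ 20 ∷ 0 ∷ 0 ∷ 0 ∷ 0 ∷ 0 ∷ 0 ∷ 21 ∷ 0 ∷ 0 ∷ []) ∷
  (0 ∷ 0 ∷ 17 ∷ 0 ∷ 0 ∷ 0 ∷ 0 ∷ 0 ∷ 20 ∷ 0 ∷ 0 ∷ 0 ∷ 0 ∷ 0 ∷ 0 ∷ 0 ∷ 0 ∷ 21 ∷ 0 ∷ []) ∷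
  (0 ∷ 17 ∷ 0 ∷ 0 ∷ 22 ∷ 0 ∷ 0 ∷ 20 ∷ 0 ∷ 0 ∷ 0 ∷ 23 ∷ 0 ∷ 0 ∷ 0 ∷ 0 ∷ 0 ∷ 0 ∷ 0 ∷ []) ∷
  (0 ∷ 0 ∷ 0 ∷ 0 ∷ 0 ∷ 22 ∷ 0 ∷ 0 ∷ 0 ∷ 0 ∷ 23 ∷ 0 ∷ 0 ∷ 0 ∷ 0 ∷ 0 ∷ 0 ∷ 0 ∷ 24 ∷ []) ∷
  (24 ∷ 0 ∷ 0 ∷ 25 ∷ 0 ∷ 0 ∷ 22 ∷ 0 ∷ 0 ∷ 23 ∷ 0 ∷ 0 ∷ 26 ∷ 0 ∷ 0 ∷ 0 ∷ 0 ∷ 0 ∷ 0 ∷ []) ∷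
  (0 ∷ 0 ∷ 25 ∷ 0 ∷ 0 ∷ 0 ∷ 0 ∷ 0 ∷ 23 ∷ 0 ∷ 0 ∷ 0 ∷ 0 ∷ 26 ∷ 0 ∷ 0 ∷ 0 ∷ 0 ∷ 0 ∷ []) ∷
  (0 ∷ 0 ∷ 0 ∷ 0 ∷ 0 ∷ 2 ∷ 0 ∷ 0 ∷ 0 ∷ 0 ∷ 3 ∷ 0 ∷ 0 ∷ 0 ∷ 0 ∷ 5 ∷ 0 ∷ 0 ∷ 0 ∷ []) ∷
  []

colours₂₀ : Vec (Fin 4) 20
colours₂₀ = # 0 ∷ # 1 ∷ # 2 ∷ # 0 ∷ # 1 ∷ # 3 ∷ # 0 ∷ # 1 ∷ # 2 ∷ # 0 ∷ # 3 ∷ # 1 ∷ # 0 ∷ # 2 ∷ # 1 ∷ # 0 ∷ # 3 ∷ # 1 ∷ # 2 ∷ # 3 ∷ []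

labels₂₀ : Vec (Vec ℕ 20) 20
labels₂₀ =
  (0 ∷ 0 ∷ 0 ∷ 1 ∷ 0 ∷ 0 ∷ 2 ∷ 0 ∷ 0 ∷ 3 ∷ 0 ∷ 0 ∷ 4 ∷ 0 ∷ 0 ∷ 5 ∷ 0 ∷ 0 ∷ 0 ∷ 0 ∷ []) ∷
  (0 ∷ 0 ∷ 0 ∷ 0 ∷ 1 ∷ 0 ∷ 0 ∷ 2 ∷ 0 ∷ 0 ∷ 0 ∷ 4 ∷ 0 ∷ 0 ∷ 5 ∷ 0 ∷ 0 ∷ 6 ∷ 0 ∷ 0 ∷ []) ∷
  (0 ∷ 0 ∷ 0 ∷ 0 ∷ 0 ∷ 0 ∷ 0 ∷ 0 ∷ 2 ∷ 0 ∷ 0 ∷ 0 ∷ 0 ∷ 5 ∷ 0 ∷ 0 ∷ 0 ∷ 0 ∷ 6 ∷ 0 ∷ []) ∷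
  (7 ∷ 0 ∷ 0 ∷ 0 ∷ 0 ∷ 0 ∷ 8 ∷ 0 ∷ 0 ∷ 2 ∷ 0 ∷ 0 ∷ 5 ∷ 0 ∷ 0 ∷ 9 ∷ 0 ∷ 0 ∷ 0 ∷ 0 ∷ []) ∷
  (0 ∷ 7 ∷ 0 ∷ 0 ∷ 0 ∷ 0 ∷ 0 ∷ 8 ∷ 0 ∷ 0 ∷ 0 ∷ 5 ∷ 0 ∷ 0 ∷ 9 ∷ 0 ∷ 0 ∷ 10 ∷ 0 ∷ 0 ∷ []) ∷
  (0 ∷ 0 ∷ 0 ∷ 0 ∷ 0 ∷ 0 ∷ 0 ∷ 0 ∷ 0 ∷ 0 ∷ 5 ∷ 0 ∷ 0 ∷ 0 ∷ 0 ∷ 0 ∷ 10 ∷ 0 ∷ 0 ∷ 11 ∷ []) ∷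
  (11 ∷ 0 ∷ 0 ∷ 12 ∷ 0 ∷ 0 ∷ 0 ∷ 0 ∷ 0 ∷ 5 ∷ 0 ∷ 0 ∷ 13 ∷ 0 ∷ 0 ∷ 10 ∷ 0 ∷ 0 ∷ 0 ∷ 0 ∷ []) ∷
  (0 ∷ 11 ∷ 0 ∷ 0 ∷ 12 ∷ 0 ∷ 0 ∷ 0 ∷ 0 ∷ 0 ∷ 0 ∷ 13 ∷ 0 ∷ 0 ∷ 10 ∷ 0 ∷ 0 ∷ 14 ∷ 0 ∷ 0 ∷ []) ∷
  (0 ∷ 0 ∷ 11 ∷ 0 ∷ 0 ∷ 0 ∷ 0 ∷ 0 ∷ 0 ∷ 0 ∷ 0 ∷ 0 ∷ 0 ∷ 10 ∷ 0 ∷ 0 ∷ 0 ∷ 0 ∷ 14 ∷ 0 ∷ []) ∷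
  (15 ∷ 0 ∷ 0 ∷ 11 ∷ 0 ∷ 0 ∷ 16 ∷ 0 ∷ 0 ∷ 0 ∷ 0 ∷ 0 ∷ 10 ∷ 0 ∷ 0 ∷ 17 ∷ 0 ∷ 0 ∷ 0 ∷ 0 ∷ []) ∷
  (0 ∷ 0 ∷ 0 ∷ 0 ∷ 0 ∷ 16 ∷ 0 ∷ 0 ∷ 0 ∷ 0 ∷ 0 ∷ 0 ∷ 0 ∷ 0 ∷ 0 ∷ 0 ∷ 17 ∷ 0 ∷ 0 ∷ 15 ∷ []) ∷
  (0 ∷ 18 ∷ 0 ∷ 0 ∷ 16 ∷ 0 ∷ 0 ∷ 19 ∷ 0 ∷ 0 ∷ 0 ∷ 0 ∷ 0 ∷ 0 ∷ 20 ∷ 0 ∷ 0 ∷ 17 ∷ 0 ∷ 0 ∷ []) ∷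
  (18 ∷ 0 ∷ 0 ∷ 16 ∷ 0 ∷ 0 ∷ 19 ∷ 0 ∷ 0 ∷ 21 ∷ 0 ∷ 0 ∷ 0 ∷ 0 ∷ 0 ∷ 20 ∷ 0 ∷ 0 ∷ 0 ∷ 0 ∷ []) ∷
  (0 ∷ 0 ∷ 16 ∷ 0 ∷ 0 ∷ 0 ∷ 0 ∷ 0 ∷ 21 ∷ 0 ∷ 0 ∷ 0 ∷ 0 ∷ 0 ∷ 0 ∷ 0 ∷ 0 ∷ 0 ∷ 22 ∷ 0 ∷ []) ∷
  (0 ∷ 16 ∷ 0 ∷ 0 ∷ 23 ∷ 0 ∷ 0 ∷ 21 ∷ 0 ∷ 0 ∷ 0 ∷ 24 ∷ 0 ∷ 0 ∷ 0 ∷ 0 ∷ 0 ∷ 22 ∷ 0 ∷ 0 ∷ []) ∷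
  (16 ∷ 0 ∷ 0 ∷ 23 ∷ 0 ∷ 0 ∷ 21 ∷ 0 ∷ 0 ∷ 25 ∷ 0 ∷ 0 ∷ 24 ∷ 0 ∷ 0 ∷ 0 ∷ 0 ∷ 0 ∷ 0 ∷ 0 ∷ []) ∷
  (0 ∷ 0 ∷ 0 ∷ 0 ∷ 0 ∷ 21 ∷ 0 ∷ 0 ∷ 0 ∷ 0 ∷ 25 ∷ 0 ∷ 0 ∷ 0 ∷ 0 ∷ 0 ∷ 0 ∷ 0 ∷ 0 ∷ 16 ∷ []) ∷
  (0 ∷ 26 ∷ 0 ∷ 0 ∷ 21 ∷ 0 ∷ 0 ∷ 27 ∷ 0 ∷ 0 ∷ 0 ∷ 25 ∷ 0 ∷ 0 ∷ 28 ∷ 0 ∷ 0 ∷ 0 ∷ 0 ∷ 0 ∷ []) ∷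
  (0 ∷ 0 ∷ 26 ∷ 0 ∷ 0 ∷ 0 ∷ 0 ∷ 0 ∷ 27 ∷ 0 ∷ 0 ∷ 0 ∷ 0 ∷ 28 ∷ 0 ∷ 0 ∷ 0 ∷ 0 ∷ 0 ∷ 0 ∷ []) ∷
  (0 ∷ 0 ∷ 0 ∷ 0 ∷ 0 ∷ 2 ∷ 0 ∷ 0 ∷ 0 ∷ 0 ∷ 3 ∷ 0 ∷ 0 ∷ 0 ∷ 0 ∷ 0 ∷ 5 ∷ 0 ∷ 0 ∷ 0 ∷ []) ∷
  []

colours₂₁ : Vec (Fin 4) 21
colours₂₁ = # 0 ∷ # 1 ∷ # 2 ∷ # 0 ∷ # 1 ∷ # 3 ∷ # 0 ∷ # 1 ∷ # 2 ∷ # 0 ∷ # 3 ∷ # 1 ∷ # 0 ∷ # 2 ∷ # 1 ∷ # 0 ∷ # 3 ∷ # 1 ∷ # 0 ∷ # 2 ∷ # 3 ∷ []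

labels₂₁ : Vec (Vec ℕ 21) 21
labels₂₁ =
  (0 ∷ 0 ∷ 0 ∷ 1 ∷ 0 ∷ 0 ∷ 2 ∷ 0 ∷ 0 ∷ 3 ∷ 0 ∷ 0 ∷ 4 ∷ 0 ∷ 0 ∷ 5 ∷ 0 ∷ 0 ∷ 6 ∷ 0 ∷ 0 ∷ []) ∷
  (0 ∷ 0 ∷ 0 ∷ 0 ∷ 1 ∷ 0 ∷ 0 ∷ 2 ∷ 0 ∷ 0 ∷ 0 ∷ 4 ∷ 0 ∷ 0 ∷ 5 ∷ 0 ∷ 0 ∷ 6 ∷ 0 ∷ 0 ∷ 0 ∷ []) ∷
  (0 ∷ 0 ∷ 0 ∷ 0 ∷ 0 ∷ 0 ∷ 0 ∷ 0 ∷ 2 ∷ 0 ∷ 0 ∷ 0 ∷ 0 ∷ 5 ∷ 0 ∷ 0 ∷ 0 ∷ 0 ∷ 0 ∷ 7 ∷ 0 ∷ []) ∷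
  (8 ∷ 0 ∷ 0 ∷ 0 ∷ 0 ∷ 0 ∷ 9 ∷ 0 ∷ 0 ∷ 2 ∷ 0 ∷ 0 ∷ 5 ∷ 0 ∷ 0 ∷ 10 ∷ 0 ∷ 0 ∷ 7 ∷ 0 ∷ 0 ∷ []) ∷
  (0 ∷ 8 ∷ 0 ∷ 0 ∷ 0 ∷ 0 ∷ 0 ∷ 9 ∷ 0 ∷ 0 ∷ 0 ∷ 5 ∷ 0 ∷ 0 ∷ 10 ∷ 0 ∷ 0 ∷ 7 ∷ 0 ∷ 0 ∷ 0 ∷ []) ∷
  (0 ∷ 0 ∷ 0 ∷ 0 ∷ 0 ∷ 0 ∷ 0 ∷ 0 ∷ 0 ∷ 0 ∷ 5 ∷ 0 ∷ 0 ∷ 0 ∷ 0 ∷ 0 ∷ 7 ∷ 0 ∷ 0 ∷ 0 ∷ 11 ∷ []) ∷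
  (11 ∷ 0 ∷ 0 ∷ 12 ∷ 0 ∷ 0 ∷ 0 ∷ 0 ∷ 0 ∷ 5 ∷ 0 ∷ 0 ∷ 13 ∷ 0 ∷ 0 ∷ 7 ∷ 0 ∷ 0 ∷ 14 ∷ 0 ∷ 0 ∷ []) ∷
  (0 ∷ 11 ∷ 0 ∷ 0 ∷ 12 ∷ 0 ∷ 0 ∷ 0 ∷ 0 ∷ 0 ∷ 0 ∷ 13 ∷ 0 ∷ 0 ∷ 7 ∷ 0 ∷ 0 ∷ 14 ∷ 0 ∷ 0 ∷ 0 ∷ []) ∷
  (0 ∷ 0 ∷ 11 ∷ 0 ∷ 0 ∷ 0 ∷ 0 ∷ 0 ∷ 0 ∷ 0 ∷ 0 ∷ 0 ∷ 0 ∷ 7 ∷ 0 ∷ 0 ∷ 0 ∷ 0 ∷ 0 ∷ 15 ∷ 0 ∷ []) ∷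
  (16 ∷ 0 ∷ 0 ∷ 11 ∷ 0 ∷ 0 ∷ 17 ∷ 0 ∷ 0 ∷ 0 ∷ 0 ∷ 0 ∷ 7 ∷ 0 ∷ 0 ∷ 18 ∷ 0 ∷ 0 ∷ 15 ∷ 0 ∷ 0 ∷ []) ∷
  (0 ∷ 0 ∷ 0 ∷ 0 ∷ 0 ∷ 17 ∷ 0 ∷ 0 ∷ 0 ∷ 0 ∷ 0 ∷ 0 ∷ 0 ∷ 0 ∷ 0 ∷ 0 ∷ 18 ∷ 0 ∷ 0 ∷ 0 ∷ 16 ∷ []) ∷
  (0 ∷ 19 ∷ 0 ∷ 0 ∷ 17 ∷ 0 ∷ 0 ∷ 20 ∷ 0 ∷ 0 ∷ 0 ∷ 0 ∷ 0 ∷ 0 ∷ 21 ∷ 0 ∷ 0 ∷ 18 ∷ 0 ∷ 0 ∷ 0 ∷ []) ∷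
  (19 ∷ 0 ∷ 0 ∷ 17 ∷ 0 ∷ 0 ∷ 20 ∷ 0 ∷ 0 ∷ 22 ∷ 0 ∷ 0 ∷ 0 ∷ 0 ∷ 0 ∷ 21 ∷ 0 ∷ 0 ∷ 18 ∷ 0 ∷ 0 ∷ []) ∷
  (0 ∷ 0 ∷ 17 ∷ 0 ∷ 0 ∷ 0 ∷ 0 ∷ 0 ∷ 22 ∷ 0 ∷ 0 ∷ 0 ∷ 0 ∷ 0 ∷ 0 ∷ 0 ∷ 0 ∷ 0 ∷ 0 ∷ 18 ∷ 0 ∷ []) ∷
  (0 ∷ 17 ∷ 0 ∷ 0 ∷ 23 ∷ 0 ∷ 0 ∷ 22 ∷ 0 ∷ 0 ∷ 0 ∷ 24 ∷ 0 ∷ 0 ∷ 0 ∷ 0 ∷ 0 ∷ 25 ∷ 0 ∷ 0 ∷ 0 ∷ []) ∷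
  (17 ∷ 0 ∷ 0 ∷ 23 ∷ 0 ∷ 0 ∷ 22 ∷ 0 ∷ 0 ∷ 26 ∷ 0 ∷ 0 ∷ 24 ∷ 0 ∷ 0 ∷ 0 ∷ 0 ∷ 0 ∷ 25 ∷ 0 ∷ 0 ∷ []) ∷
  (0 ∷ 0 ∷ 0 ∷ 0 ∷ 0 ∷ 22 ∷ 0 ∷ 0 ∷ 0 ∷ 0 ∷ 26 ∷ 0 ∷ 0 ∷ 0 ∷ 0 ∷ 0 ∷ 0 ∷ 0 ∷ 0 ∷ 0 ∷ 17 ∷ []) ∷
  (0 ∷ 27 ∷ 0 ∷ 0 ∷ 22 ∷ 0 ∷ 0 ∷ 28 ∷ 0 ∷ 0 ∷ 0 ∷ 26 ∷ 0 ∷ 0 ∷ 29 ∷ 0 ∷ 0 ∷ 0 ∷ 0 ∷ 0 ∷ 0 ∷ []) ∷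
  (27 ∷ 0 ∷ 0 ∷ 22 ∷ 0 ∷ 0 ∷ 28 ∷ 0 ∷ 0 ∷ 30 ∷ 0 ∷ 0 ∷ 26 ∷ 0 ∷ 0 ∷ 29 ∷ 0 ∷ 0 ∷ 0 ∷ 0 ∷ 0 ∷ []) ∷
  (0 ∷ 0 ∷ 22 ∷ 0 ∷ 0 ∷ 0 ∷ 0 ∷ 0 ∷ 30 ∷ 0 ∷ 0 ∷ 0 ∷ 0 ∷ 26 ∷ 0 ∷ 0 ∷ 0 ∷ 0 ∷ 0 ∷ 0 ∷ 0 ∷ []) ∷
  (0 ∷ 0 ∷ 0 ∷ 0 ∷ 0 ∷ 2 ∷ 0 ∷ 0 ∷ 0 ∷ 0 ∷ 3 ∷ 0 ∷ 0 ∷ 0 ∷ 0 ∷ 0 ∷ 5 ∷ 0 ∷ 0 ∷ 0 ∷ 0 ∷ []) ∷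
  []

FourColourable : ℕ → Set
FourColourable n = Σ (Coloring (Cycle n) 4) (WalkNonrepetitive (Cycle n))

certifiedLengths : List ℕ
certifiedLengths = 4 ∷ 6 ∷ 8 ∷ 9 ∷ 10 ∷ 11 ∷ 12 ∷ 13 ∷ 14 ∷ 15 ∷ 16 ∷ 17 ∷ 18 ∷ 19 ∷ 20 ∷ 21 ∷ []

four-colourings : All FourColourable certifiedLengths
four-colourings =
  certified colours₄ (replicate 4 (replicate 4 0)) ∷
  certified colours₆ labels₆ ∷
  certified colours₈ labels₈ ∷
  certified colours₉ labels₉ ∷
  certified colours₁₀ labels₁₀ ∷
  certified colours₁₁ labels₁₁ ∷
  certified colours₁₂ labels₁₂ ∷
  certified colours₁₃ labels₁₃ ∷
  certified colours₁₄ labels₁₄ ∷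
  certified colours₁₅ labels₁₅ ∷
  certified colours₁₆ labels₁₆ ∷
  certified colours₁₇ labels₁₇ ∷
  certified colours₁₈ labels₁₈ ∷
  certified colours₁₉ labels₁₉ ∷
  certified colours₂₀ labels₂₀ ∷
  certified colours₂₁ labels₂₁ ∷
  []

certifiedLengths-complete : ∀ {n} → n < 22 → 4 ≤ n → n ≢ 5 → n ≢ 7 → n ∈ certifiedLengths
certifiedLengths-complete = toWitness {a? = ℕ.allUpTo? (λ n →
  4 ℕ.≤? n →-dec ¬? (n ℕ.≟ 5) →-dec ¬? (n ℕ.≟ 7) →-dec n ∈? certifiedLengths) 22} _

four-colourable : ∀ {n} → 4 ≤ n → n ≤ 21 → n ≢ 5 → n ≢ 7 → FourColourable n
four-colourable 4≤n n≤21 n≢5 n≢7 =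
  All.lookup four-colourings (certifiedLengths-complete (s≤s n≤21) 4≤n n≢5 n≢7)

cycle-σ≡4 : ∀ {n} → 4 ≤ n → n ≤ 21 → n ≢ 5 → n ≢ 7 → σ≡ (Cycle n) 4
cycle-σ≡4 4≤n n≤21 n≢5 n≢7 = four-colourable 4≤n n≤21 n≢5 n≢7 , fewer-than-four-colours 4≤n

cycle-σ≡5 : ∀ {n} .{{_ : NonZero n}} → 4 ≤ n →
            Σ (Coloring (Cycle n) 5) (WalkNonrepetitive (Cycle n)) →
            (∀ (v : Vec (Fin 4) n) → Obstructed (lookup v)) → σ≡ (Cycle n) 5
cycle-σ≡5 {n} 4≤n colouring obstructed = colouring , fewer-than-five-colours
  where
  fewer-than-five-colours : ∀ m → m < 5 → (c : Coloring (Cycle n) m) →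
                            ¬ WalkNonrepetitive (Cycle n) c
  fewer-than-five-colours m m<5 c with ℕ.m<1+n⇒m<n∨m≡n m<5
  ... | inj₁ m<4  = fewer-than-four-colours 4≤n m m<4 c
  ... | inj₂ refl = no-four-colouring 4≤n obstructed c

proposition6 :
    (∀ (n : ℕ) → 4 ≤ n → n ≤ 21 → n ≢ 5 → n ≢ 7 →
      σ≡ (Cycle n) 4) ×
    (∀ (n : ℕ) → (n ≡ 5 ⊎ n ≡ 7) → σ≡ (Cycle n) 5)
proposition6 = (λ _ → cycle-σ≡4) , λ
  { .5 (inj₁ refl) → cycle-σ≡5 (ℕ.m≤m+n 4 1) (certified colours₅ (replicate 5 (replicate 5 0)))
                               four-colourings-obstructed₅
  ; .7 (inj₂ refl) → cycle-σ≡5 (ℕ.m≤m+n 4 3) (certified colours₇ labels₇)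
                               four-colourings-obstructed₇
  }
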